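{- For every positive integer $v$, with $m=\frac12\binom v2$: $S(v,e)>C(v,e)$ for all integers $4\le e<m-v/2$, and $S(v,e)<C(v,e)$ for all integers $m+v/2<e\le\binom v2-4$.
   Context: For a graph $G$ with degrees $d_1,\dots,d_v$, $P_2(G)=\sum d_i^2$. For $0\le e\le\binom v2$ write $e=\binom{k+1}2-j$ with integers $1\le j\le k$; the quasi-complete graph on $v$ vertices with $e$ edges consists of a complete graph on vertices $1,\dots,k$, a vertex $k+1$ adjacent to vertices $1,\dots,k-j$, and $v-k-1$ isolated vertices; $C(v,e)$ is its $P_2$ value. The quasi-star graph with $v$ vertices and $e$ edges is the complement of the quasi-complete graph with $v$ vertices and $\binom v2-e$ edges; $S(v,e)$ is its $P_2$ value. -}

module Defs where

open import Data.Nat using (ℕ; zero; suc; _+_; _*_; _∸_; _≡ᵇ_; _<ᵇ_)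
open import Data.Nat.Combinatorics using (_C_)
open import Data.Bool using (Bool; true; false; _∧_; _∨_; not; if_then_else_)
open import Data.Fin using (Fin; toℕ)
open import Data.List using (List; map; allFin)
open import Data.Nat.ListAction using (sum)
open import Data.Fin using (_≟_)
open import Relation.Nullary.Decidable using (⌊_⌋)

Graph : ℕ → Set
Graph v = Fin v → Fin v → Bool

degree : ∀ {v} → Graph v → Fin v → ℕ
degree {v} G a = sum (map (λ b → if G a b then 1 else 0) (allFin v))

P₂ : ∀ {v} → Graph v → ℕ
P₂ {v} G = sum (map (λ a → degree G a * degree G a) (allFin v))

-- For e, the unique k ≥ 1 with  binom(k,2) ≤ e < binom(k+1,2),
-- i.e. e = binom(k+1,2) - j with 1 ≤ j ≤ k.
kOf : ℕ → ℕ
kOf zero = 1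
kOf (suc e) with kOf e
... | k = if suc e ≡ᵇ (suc k C 2) then suc k else k

jOf : ℕ → ℕ
jOf e = (suc (kOf e) C 2) ∸ e

-- Quasi-complete graph with vertices labelled 0..v-1 (paper's vertex i is our i-1):
-- clique on 0..k-1, vertex k adjacent to 0..k-j-1, remaining vertices isolated.
quasiComplete : (v e : ℕ) → Graph v
quasiComplete v e a b =
  not ⌊ a ≟ b ⌋ ∧
  (((x <ᵇ k) ∧ (y <ᵇ k)) ∨ ((x ≡ᵇ k) ∧ (y <ᵇ (k ∸ j))) ∨ ((y ≡ᵇ k) ∧ (x <ᵇ (k ∸ j))))
  where
  k = kOf e
  j = jOf e
  x = toℕ a
  y = toℕ b

complement : ∀ {v} → Graph v → Graph v
complement G a b = not ⌊ a ≟ b ⌋ ∧ not (G a b)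

quasiStar : (v e : ℕ) → Graph v
quasiStar v e = complement (quasiComplete v ((v C 2) ∸ e))

Cval : ℕ → ℕ → ℕ
Cval v e = P₂ (quasiComplete v e)

Sval : ℕ → ℕ → ℕ
Sval v e = P₂ (quasiStar v e)

module Submission where

-- Write e = C(k,2) + r with 0 ≤ r < k.  The quasi-complete graph has r vertices of degree k,
-- k − r of degree k − 1, one of degree r and isolated ones, so C(v,e) = rk² + (k−r)(k−1)² + r²
-- and its degree sum is 2e.  For any loopless graph the complement has degrees v − 1 − d, so
-- P₂(Ḡ) + 2(v−1)·Σd = v(v−1)² + P₂(G); with e′ = C(v,2) − e this gives
--   S(v,e) + 4(v−1)e′ = v(v−1)² + C(v,e′),
-- hence the symmetry S(v,e) + S(v,e′) = C(v,e) + C(v,e′), which turns the second half into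
-- the first one applied to e′.  The first half becomes a polynomial inequality between the
-- parameters (k,r) of e and (K,R) of e′; with Z = v−1−K, d = K−k, s = k+K−v it reads
-- 0 < 4dZ(Z+d) + T·U for explicit T and U, proved over ℤ by a case analysis on d = 1,
-- the sign of T, and Z = 0, each case closed by a sum-of-non-negatives certificate.

-- The integer inequality behind Corollary 2.  Each step is an explicit certificate: a
-- polynomial identity (checked by the ring solver) exhibiting a quantity as a sum of
-- products of quantities already known to be non-negative.
module PolynomialInequality where

  open import Data.Nat.Base as ℕ using (ℕ; z≤n)
  open import Data.Integer.Base
    using (ℤ; +_; -[1+_]; 0ℤ; 1ℤ; _+_; _-_; _*_; -_; _≤_; _<_; +≤+)
  open import Data.Integer.Properties
    using (pos-*; drop‿+<+; +-mono-≤; +-monoʳ-<; *-zeroʳ; +-identityʳ; i≤j⇒0≤j-i; 0≤i-j⇒j≤i;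
           suc[i]≤j⇒i<j; i<j⇒suc[i]≤j; ≤∧≢⇒<; ≰⇒>; <⇒≤; ≤-refl; ≤-trans; neg-mono-≤;
           i≡j⇒i-j≡0; *-cancelˡ-<-nonNeg; _≟_; _≤?_)
  open import Data.Integer.Tactic.RingSolver using (solve-∀)
  open import Data.Empty using (⊥; ⊥-elim)
  open import Function using (_∘_)
  open import Relation.Nullary using (Dec; yes; no; ¬_)
  open import Relation.Binary.PropositionalEquality
    using (_≡_; _≢_; refl; sym; trans; cong; cong₂; subst; subst₂)

  0≤-ℕ : ∀ n → 0ℤ ≤ + n
  0≤-ℕ n = +≤+ z≤n

  0≤-+ : ∀ {x y} → 0ℤ ≤ x → 0ℤ ≤ y → 0ℤ ≤ x + y
  0≤-+ = +-mono-≤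

  0≤-* : ∀ {x y} → 0ℤ ≤ x → 0ℤ ≤ y → 0ℤ ≤ x * y
  0≤-* (+≤+ {n = m} _) (+≤+ {n = n} _) = subst (0ℤ ≤_) (pos-* m n) (+≤+ z≤n)

  0≤-sq : ∀ x → 0ℤ ≤ x * x
  0≤-sq (+ n)    = 0≤-* (0≤-ℕ n) (0≤-ℕ n)
  0≤-sq -[1+ n ] = +≤+ z≤n

  gap : ∀ {a b} → a ≤ b → 0ℤ ≤ b - a
  gap = i≤j⇒0≤j-i

  certify : ∀ {E F} → E ≡ F → 0ℤ ≤ F → 0ℤ ≤ E
  certify refl h = h

  refute : ∀ {x w} → 0ℤ ≤ x → 0ℤ ≤ w → x ≡ - (1ℤ + w) → ⊥
  refute (+≤+ _) (+≤+ _) ()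

  vanish : ∀ {X Y} m {ε} → ε ≡ 0ℤ → X ≡ Y + m * ε → X ≡ Y
  vanish {Y = Y} m refl e = trans e (trans (cong (λ t → Y + t) (*-zeroʳ m)) (+-identityʳ Y))

  -- Case analysis on a decision, used where the goal is too large for with-abstraction.
  by-cases : ∀ {A B : Set} → Dec A → (A → B) → (¬ A → B) → B
  by-cases (yes a) f g = f a
  by-cases (no ¬a) f g = g ¬a

  successor : ∀ {a b} → a ≤ b → a ≢ b → 1ℤ + a ≤ b
  successor a≤b a≢b = i<j⇒suc[i]≤j (≤∧≢⇒< a≤b a≢b)

  <-from-difference : ∀ {a b} → 0ℤ < b - a → a < b
  <-from-difference {a} {b} 0<b-a = subst₂ _<_ (+-identityʳ a) (a+[b-a]≡b a b) (+-monoʳ-< a 0<b-a)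
    where
    a+[b-a]≡b : ∀ a b → a + (b - a) ≡ b
    a+[b-a]≡b = solve-∀

  -- For the quasi-complete graphs with e = C(k,2) + r and
  -- e′ = C(K,2) + R edges (e + e′ = C(v,2)) put Z = v−1−K, d = K−k, s = k+K−v.  Then
  -- 4(S(v,e) − C(v,e)) = G Z d s r, where P = Z(Z+d) is the product of the numbers of
  -- isolated vertices of the two graphs, T = 2(r + R + 1 − (v−k) − (v−K)) and U = 2(R − r − d).
  P : ℤ → ℤ → ℤ
  P Z d = Z * (Z + d)

  T : ℤ → ℤ → ℤ → ℤ
  T Z d s = + 2 * P Z d - s * (s - 1ℤ)

  U : ℤ → ℤ → ℤ → ℤ → ℤ
  U Z d s r = T Z d s - + 4 * r + + 4 * Z + + 2

  G : ℤ → ℤ → ℤ → ℤ → ℤ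
  G Z d s r = + 4 * d * P Z d + T Z d s * U Z d s r

  private
    certificate-d≡1 : ∀ Z s r →
      let P = Z * (Z + 1ℤ) ; T = + 2 * P - s * (s - 1ℤ) ; U = T - + 4 * r + + 4 * Z + + 2
          A = U - (+ 2 * Z + + 4)
      in + 4 * 1ℤ * P + T * U - 1ℤ ≡ + 7 + + 6 * A + A * A + + 4 * r * (+ 2 * Z + + 4 + A)
    certificate-d≡1 = solve-∀

    certificate-T≥0 : ∀ Z d s r →
      let P = Z * (Z + d) ; T = + 2 * P - s * (s - 1ℤ) ; U = T - + 4 * r + + 4 * Z + + 2
      in + 4 * d * P + T * U - 1ℤ ≡
         + 4 * (d - + 2) * Z * (Z + (d - + 2) + + 2) + (T - + 2 * s + + 3) * (T - + 2 * s + + 3)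
         + + 8 * (s - + 2) + + 6 + + 4 * (Z + s - r) * T
    certificate-T≥0 = solve-∀

    certificate-T≤0 : ∀ Z d s r →
      let m = Z - 1ℤ ; P = Z * (Z + d) ; T = + 2 * P - s * (s - 1ℤ) ; U = T - + 4 * r + + 4 * Z + + 2
      in + 4 * d * P + T * U - 1ℤ ≡
         + 4 * (d - + 2) * Z * (Z + (d - + 2) + + 2) + + 8 * Z * (d - + 2)
         + (- T - + 2 * Z - 1ℤ) * (- T - + 2 * Z - 1ℤ) + + 4 * m * (m + + 5) + + 14 + + 4 * r * (- T)
    certificate-T≤0 = solve-∀

    certificate-s≡2 : ∀ d s r →
      let P = 0ℤ * (0ℤ + d) ; T = + 2 * P - s * (s - 1ℤ) ; U = T - + 4 * r + + 4 * 0ℤ + + 2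
      in + 4 * d * P + T * U - 1ℤ ≡ + 4 * ((0ℤ + s + 1ℤ) * (0ℤ + s) + + 2 * r - + 8) + + 7
         + (s * s * s + + 4 * s * r - + 5 * s + + 4 * r - + 12) * (s - + 2)
    certificate-s≡2 = solve-∀

    certificate-s≥3 : ∀ d σ r →
      let s = σ + + 3 ; q = σ * σ + + 5 * σ
          P = 0ℤ * (0ℤ + d) ; T = + 2 * P - s * (s - 1ℤ) ; U = T - + 4 * r + + 4 * 0ℤ + + 2
      in + 4 * d * P + T * U - 1ℤ ≡ (q + + 6) * (q + + 4 * r) + + 4 * q + + 23
    certificate-s≥3 = solve-∀

    shift-by-3 : ∀ s → s ≡ s - + 3 + + 3
    shift-by-3 = solve-∀

  -- K = k + 1: the window condition makes U large.
  G>0-when-d≡1 : ∀ Z s r → 0ℤ ≤ Z → 0ℤ ≤ r → + 2 * Z + + 4 ≤ U Z 1ℤ s r → 0ℤ ≤ G Z 1ℤ s r - 1ℤ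
  G>0-when-d≡1 Z s r hZ hr hU = certify (certificate-d≡1 Z s r)
    (0≤-+ (0≤-+ (0≤-+ (0≤-ℕ 7) (0≤-* (0≤-ℕ 6) hA)) (0≤-sq A))
          (0≤-* (0≤-* (0≤-ℕ 4) hr) (0≤-+ (0≤-+ (0≤-* (0≤-ℕ 2) hZ) (0≤-ℕ 4)) hA)))
    where
    A : ℤ
    A = U Z 1ℤ s r - (+ 2 * Z + + 4)
    hA : 0ℤ ≤ A
    hA = gap hU

  G>0-when-T≥0 : ∀ Z d s r → 0ℤ ≤ Z → + 2 ≤ d → + 2 ≤ s → r ≤ Z + s → 0ℤ ≤ T Z d s →
    0ℤ ≤ G Z d s r - 1ℤ
  G>0-when-T≥0 Z d s r hZ hd hs hr hT = certify (certificate-T≥0 Z d s r)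
    (0≤-+ (0≤-+ (0≤-+ (0≤-+ (0≤-* (0≤-* (0≤-* (0≤-ℕ 4) (gap hd)) hZ) (0≤-+ (0≤-+ hZ (gap hd)) (0≤-ℕ 2)))
                            (0≤-sq (T Z d s - + 2 * s + + 3)))
                     (0≤-* (0≤-ℕ 8) (gap hs)))
                (0≤-ℕ 6))
          (0≤-* (0≤-* (0≤-ℕ 4) (gap hr)) hT))

  G>0-when-T≤0 : ∀ Z d s r → 1ℤ ≤ Z → + 2 ≤ d → 0ℤ ≤ r → T Z d s ≤ 0ℤ → 0ℤ ≤ G Z d s r - 1ℤ
  G>0-when-T≤0 Z d s r hZ hd hr hT = certify (certificate-T≤0 Z d s r)
    (0≤-+ (0≤-+ (0≤-+ (0≤-+ (0≤-+ (0≤-* (0≤-* (0≤-* (0≤-ℕ 4) (gap hd)) Z≥0) (0≤-+ (0≤-+ Z≥0 (gap hd)) (0≤-ℕ 2)))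
                                   (0≤-* (0≤-* (0≤-ℕ 8) Z≥0) (gap hd)))
                            (0≤-sq (- T Z d s - + 2 * Z - 1ℤ)))
                     (0≤-* (0≤-* (0≤-ℕ 4) (gap hZ)) (0≤-+ (gap hZ) (0≤-ℕ 5))))
                (0≤-ℕ 14))
          (0≤-* (0≤-* (0≤-ℕ 4) hr) (neg-mono-≤ hT)))
    where
    Z≥0 : 0ℤ ≤ Z
    Z≥0 = ≤-trans (+≤+ z≤n) hZ

  -- Z = 0: then G = s(s−1)(s(s−1) + 4r − 2), positive because e ≥ 4.
  G>0-when-Z≡0 : ∀ d s r → + 2 ≤ s → 0ℤ ≤ r → + 8 ≤ (0ℤ + s + 1ℤ) * (0ℤ + s) + + 2 * r →
    0ℤ ≤ G 0ℤ d s r - 1ℤ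
  G>0-when-Z≡0 d s r hs hr he = by-cases (s ≟ + 2)
    (λ s≡2 → certify (vanish (s * s * s + + 4 * s * r - + 5 * s + + 4 * r - + 12) (cong (_- + 2) s≡2)
                             (certificate-s≡2 d s r))
                     (0≤-+ (0≤-* (0≤-ℕ 4) (gap he)) (0≤-ℕ 7)))
    (λ s≢2 → subst (λ s → 0ℤ ≤ G 0ℤ d s r - 1ℤ) (sym (shift-by-3 s)) (certify (certificate-s≥3 d (s - + 3) r)
      (0≤-+ (0≤-+ (0≤-* (0≤-+ (hq s≢2) (0≤-ℕ 6)) (0≤-+ (hq s≢2) (0≤-* (0≤-ℕ 4) hr))) (0≤-* (0≤-ℕ 4) (hq s≢2)))
            (0≤-ℕ 23))))
    where
    hq : s ≢ + 2 → 0ℤ ≤ (s - + 3) * (s - + 3) + + 5 * (s - + 3)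
    hq s≢2 = 0≤-+ (0≤-sq (s - + 3)) (0≤-* (0≤-ℕ 5) (gap (successor hs (s≢2 ∘ sym))))

  -- G is positive under the constraints satisfied by the two quasi-complete graphs:
  -- Z ≥ 0, K > k, k + K ≥ v + 2, 0 ≤ r ≤ k − 1 = Z + s, e ≥ 4, and (for K = k + 1) the
  -- window e′ − e ≥ v + 1 in the form U ≥ 2Z + 4.
  positivity : ∀ Z d s r → 0ℤ ≤ Z → 1ℤ ≤ d → + 2 ≤ s → 0ℤ ≤ r → r ≤ Z + s →
    + 8 ≤ (Z + s + 1ℤ) * (Z + s) + + 2 * r → (d ≡ 1ℤ → + 2 * Z + + 4 ≤ U Z d s r) →
    0ℤ < G Z d s r
  positivity Z d s r hZ hd hs hr hrs he hd1 = suc[i]≤j⇒i<j (0≤i-j⇒j≤i G-1≥0)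
    where
    G-1≥0 : 0ℤ ≤ G Z d s r - 1ℤ
    G-1≥0 = by-cases (d ≟ 1ℤ)
      (λ d≡1 → subst (λ d → 0ℤ ≤ G Z d s r - 1ℤ) (sym d≡1)
         (G>0-when-d≡1 Z s r hZ hr (subst (λ d → + 2 * Z + + 4 ≤ U Z d s r) d≡1 (hd1 d≡1))))
      (λ d≢1 → let d≥2 = successor hd (d≢1 ∘ sym) in by-cases (0ℤ ≤? T Z d s)
        (λ T≥0 → G>0-when-T≥0 Z d s r hZ d≥2 hs hrs T≥0)
        (λ T≱0 → by-cases (Z ≟ 0ℤ)
          (λ Z≡0 → subst (λ Z → 0ℤ ≤ G Z d s r - 1ℤ) (sym Z≡0)
             (G>0-when-Z≡0 d s r hs hr (subst (λ Z → + 8 ≤ (Z + s + 1ℤ) * (Z + s) + + 2 * r) Z≡0 he)))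
          (λ Z≢0 → G>0-when-T≤0 Z d s r (successor hZ (Z≢0 ∘ sym)) d≥2 hr (<⇒≤ (≰⇒> T≱0)))))

  -- The quasi-complete graph with k = r + j + 1: twice its number of edges, k(k−1) + 2r, and
  -- its P₂ (r vertices of degree k, j + 1 of degree k − 1, one of degree r), over ℕ and ℤ.
  edges₂ : ℕ → ℕ → ℕ
  edges₂ r j = (r ℕ.+ ℕ.suc j) ℕ.* (r ℕ.+ j) ℕ.+ 2 ℕ.* r

  qcP₂ : ℕ → ℕ → ℕ
  qcP₂ r j = r ℕ.* ((r ℕ.+ ℕ.suc j) ℕ.* (r ℕ.+ ℕ.suc j)) ℕ.+ ℕ.suc j ℕ.* ((r ℕ.+ j) ℕ.* (r ℕ.+ j)) ℕ.+ r ℕ.* r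

  edges₂ᶻ : ℤ → ℤ → ℤ
  edges₂ᶻ r j = (r + (1ℤ + j)) * (r + j) + + 2 * r

  qcP₂ᶻ : ℤ → ℤ → ℤ
  qcP₂ᶻ r j = r * ((r + (1ℤ + j)) * (r + (1ℤ + j))) + (1ℤ + j) * ((r + j) * (r + j)) + r * r

  -- The three
  -- "when" identities write a hypothesis of the theorem as −(1 + w) with w ≥ 0 once the named
  -- inequality fails; excess-normal-form is 4(S − C) = G modulo the edge-count defect ε.
  private
    edges-when-k≤2 : ∀ r j → let k = r + (1ℤ + j) ; ρ = + 3 - (1ℤ + k) in
      (r + (1ℤ + j)) * (r + j) + + 2 * r - + 8 ≡ - (1ℤ + ((r + j) * ρ + + 4 * ρ + + 3 + + 2 * j))
    edges-when-k≤2 = solve-∀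

    window-when-K≤k : ∀ r j R J z →
      let k = r + (1ℤ + j) ; K = R + (1ℤ + J) ; v = 1ℤ + (K + z) ; δ = 1ℤ - (1ℤ + (K - k)) in
      (R + (1ℤ + J)) * (R + J) + + 2 * R - ((r + (1ℤ + j)) * (r + j) + + 2 * r + + 2 * v + + 2)
        ≡ - (1ℤ + (δ * (R + J + r + j + 1ℤ) + + 2 * r + + 2 * J + + 2 * z + + 5))
    window-when-K≤k = solve-∀

    edge-count-when-s≤1 : ∀ r j R J z →
      let k = r + (1ℤ + j) ; K = R + (1ℤ + J) ; n = K + z ; v = 1ℤ + n
          s = k + K - v ; t = + 2 - (1ℤ + s) ; a = k - + 3 ; b = K - k - 1ℤ in
      (r + (1ℤ + j)) * (r + j) + + 2 * r + ((R + (1ℤ + J)) * (R + J) + + 2 * R) - v * n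
        ≡ - (1ℤ + (+ 2 * a * a + + 2 * a * b + + 6 * a + + 2 * b + 1ℤ + + 2 * j + + 2 * J
                   + t * (+ 4 * a + + 2 * b + + 11) + t * t))
    edge-count-when-s≤1 = solve-∀

    slack-of-r : ∀ r j R J z → let k = r + (1ℤ + j) ; K = R + (1ℤ + J) ; v = 1ℤ + (K + z) in
      z + (k + K - v) - r ≡ j
    slack-of-r = solve-∀

    edges-in-Z-s : ∀ r j R J z →
      let k = r + (1ℤ + j) ; K = R + (1ℤ + J) ; v = 1ℤ + (K + z) ; s = k + K - v in
      (r + (1ℤ + j)) * (r + j) + + 2 * r ≡ (z + s + 1ℤ) * (z + s) + + 2 * r
    edges-in-Z-s = solve-∀

    U-by-window : ∀ r j R J z →
      let k = r + (1ℤ + j) ; K = R + (1ℤ + J) ; n = K + z ; v = 1ℤ + n ; d = K - k ; s = k + K - v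
          P = z * (z + d) ; T = + 2 * P - s * (s - 1ℤ) ; U = T - + 4 * r + + 4 * z + + 2
          e₂ = (r + (1ℤ + j)) * (r + j) + + 2 * r ; e₂′ = (R + (1ℤ + J)) * (R + J) + + 2 * R in
      U - (+ 2 * z + + 4) ≡ e₂′ - (e₂ + + 2 * v + + 2) + (- (K + k)) * (d - 1ℤ) + (- 1ℤ) * (e₂ + e₂′ - v * n)
    U-by-window = solve-∀

    excess-normal-form : ∀ r j R J z →
      let k = r + (1ℤ + j) ; K = R + (1ℤ + J) ; n = K + z ; v = 1ℤ + n ; d = K - k ; s = k + K - v
          P = z * (z + d) ; T = + 2 * P - s * (s - 1ℤ) ; U = T - + 4 * r + + 4 * z + + 2
          e₂ = (r + (1ℤ + j)) * (r + j) + + 2 * r ; e₂′ = (R + (1ℤ + J)) * (R + J) + + 2 * R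
          ε = e₂ + e₂′ - v * n
          Q = r * ((r + (1ℤ + j)) * (r + (1ℤ + j))) + (1ℤ + j) * ((r + j) * (r + j)) + r * r
          Q′ = R * ((R + (1ℤ + J)) * (R + (1ℤ + J))) + (1ℤ + J) * ((R + J) * (R + J)) + R * R in
      + 4 * ((v * (n * n) + Q′) - (Q + + 2 * n * e₂′))
        ≡ + 4 * d * P + T * U + (- ε + + 4 * K + + 4 * R - + 8 * v + + 6) * ε
    excess-normal-form = solve-∀

  -- The two quasi-complete graphs in terms of r, j, R, J, z ≥ 0: cliques on k = r+j+1 and
  -- K = R+J+1 vertices, v = K+z+1 vertices in all (z isolated in the larger graph), n = v−1.
  module TwoGraphs (r j R J z : ℤ) where

    k K n v d s : ℤ
    k = r + (1ℤ + j)
    K = R + (1ℤ + J)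
    n = K + z
    v = 1ℤ + n
    d = K - k
    s = k + K - v

    k≥3 : 0ℤ ≤ r → 0ℤ ≤ j → + 8 ≤ edges₂ᶻ r j → + 3 ≤ k
    k≥3 hr hj e≥4 = by-cases (+ 3 ≤? k) (λ h → h) λ k≱3 → ⊥-elim
      (refute (gap e≥4) (0≤-+ (0≤-+ (0≤-+ (0≤-* (0≤-+ hr hj) (ρ≥0 k≱3)) (0≤-* (0≤-ℕ 4) (ρ≥0 k≱3))) (0≤-ℕ 3))
                              (0≤-* (0≤-ℕ 2) hj))
              (edges-when-k≤2 r j))
      where
      ρ≥0 : ¬ (+ 3 ≤ k) → 0ℤ ≤ + 3 - (1ℤ + k)
      ρ≥0 k≱3 = gap (i<j⇒suc[i]≤j (≰⇒> k≱3))

    d≥1 : 0ℤ ≤ r → 0ℤ ≤ j → 0ℤ ≤ R → 0ℤ ≤ J → 0ℤ ≤ z →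
      edges₂ᶻ r j + + 2 * v + + 2 ≤ edges₂ᶻ R J → 1ℤ ≤ d
    d≥1 hr hj hR hJ hz window = by-cases (1ℤ ≤? d) (λ h → h) λ d≱1 → ⊥-elim
      (refute (gap window)
         (0≤-+ (0≤-+ (0≤-+ (0≤-+ (0≤-* (δ≥0 d≱1) (0≤-+ (0≤-+ (0≤-+ (0≤-+ hR hJ) hr) hj) (0≤-ℕ 1)))
                                  (0≤-* (0≤-ℕ 2) hr)) (0≤-* (0≤-ℕ 2) hJ)) (0≤-* (0≤-ℕ 2) hz)) (0≤-ℕ 5))
         (window-when-K≤k r j R J z))
      where
      δ≥0 : ¬ (1ℤ ≤ d) → 0ℤ ≤ 1ℤ - (1ℤ + d)
      δ≥0 d≱1 = gap (i<j⇒suc[i]≤j (≰⇒> d≱1))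

    s≥2 : 0ℤ ≤ j → 0ℤ ≤ J → + 3 ≤ k → 1ℤ ≤ d →
      edges₂ᶻ r j + edges₂ᶻ R J - v * n ≡ 0ℤ → + 2 ≤ s
    s≥2 hj hJ k≥3 d≥1 ε≡0 = by-cases (+ 2 ≤? s) (λ h → h) λ s≱2 → ⊥-elim
      (refute (subst (0ℤ ≤_) (sym ε≡0) ≤-refl)
         (0≤-+ (0≤-+ (0≤-+ (0≤-+ (0≤-+ (0≤-+ (0≤-+ (0≤-+ (0≤-* (0≤-* (0≤-ℕ 2) a≥0) a≥0)
                                                           (0≤-* (0≤-* (0≤-ℕ 2) a≥0) b≥0))
                                                    (0≤-* (0≤-ℕ 6) a≥0))
                                             (0≤-* (0≤-ℕ 2) b≥0))
                                      (0≤-ℕ 1))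
                               (0≤-* (0≤-ℕ 2) hj))
                        (0≤-* (0≤-ℕ 2) hJ))
                 (0≤-* (t≥0 s≱2) (0≤-+ (0≤-+ (0≤-* (0≤-ℕ 4) a≥0) (0≤-* (0≤-ℕ 2) b≥0)) (0≤-ℕ 11))))
           (0≤-sq (+ 2 - (1ℤ + s))))
         (edge-count-when-s≤1 r j R J z))
      where
      a≥0 : 0ℤ ≤ k - + 3
      a≥0 = gap k≥3
      b≥0 : 0ℤ ≤ K - k - 1ℤ
      b≥0 = gap d≥1
      t≥0 : ¬ (+ 2 ≤ s) → 0ℤ ≤ + 2 - (1ℤ + s)
      t≥0 s≱2 = gap (i<j⇒suc[i]≤j (≰⇒> s≱2))

    -- C(v,e) + 4(v−1)e′ < v(v−1)² + C(v,e′) when e = C(k,2) + r ≥ 4, e + e′ = C(v,2) and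
    -- e′ − e ≥ v + 1: the difference is G/4 > 0.
    excess-positiveᶻ : 0ℤ ≤ r → 0ℤ ≤ j → 0ℤ ≤ R → 0ℤ ≤ J → 0ℤ ≤ z →
      edges₂ᶻ r j + edges₂ᶻ R J ≡ v * n →
      + 8 ≤ edges₂ᶻ r j →
      edges₂ᶻ r j + + 2 * v + + 2 ≤ edges₂ᶻ R J →
      qcP₂ᶻ r j + + 2 * n * edges₂ᶻ R J < v * (n * n) + qcP₂ᶻ R J
    excess-positiveᶻ hr hj hR hJ hz edges e≥4 window =
      <-from-difference (*-cancelˡ-<-nonNeg (+ 4) (subst (0ℤ <_) (sym excess)
        (positivity z d s r hz d≥1′ s≥2′ hr r≤z+s e≥4′ U-large)))
      where
      ε≡0 : edges₂ᶻ r j + edges₂ᶻ R J - v * n ≡ 0ℤ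
      ε≡0 = i≡j⇒i-j≡0 edges
      d≥1′ : 1ℤ ≤ d
      d≥1′ = d≥1 hr hj hR hJ hz window
      s≥2′ : + 2 ≤ s
      s≥2′ = s≥2 hj hJ (k≥3 hr hj e≥4) d≥1′ ε≡0
      r≤z+s : r ≤ z + s
      r≤z+s = 0≤i-j⇒j≤i (certify (slack-of-r r j R J z) hj)
      e≥4′ : + 8 ≤ (z + s + 1ℤ) * (z + s) + + 2 * r
      e≥4′ = subst (+ 8 ≤_) (edges-in-Z-s r j R J z) e≥4
      U-large : d ≡ 1ℤ → + 2 * z + + 4 ≤ U z d s r
      U-large d≡1 = 0≤i-j⇒j≤i (certify
        (vanish (- (K + k)) (cong (_- 1ℤ) d≡1) (vanish (- 1ℤ) ε≡0 (U-by-window r j R J z))) (gap window))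
      excess : + 4 * ((v * (n * n) + qcP₂ᶻ R J) - (qcP₂ᶻ r j + + 2 * n * edges₂ᶻ R J)) ≡ G z d s r
      excess = vanish (- (edges₂ᶻ r j + edges₂ᶻ R J - v * n) + + 4 * K + + 4 * R - + 8 * v + + 6) ε≡0
                      (excess-normal-form r j R J z)

  open TwoGraphs using (excess-positiveᶻ)

  pos-*-* : ∀ a b c → + (a ℕ.* (b ℕ.* c)) ≡ + a * (+ b * + c)
  pos-*-* a b c = trans (pos-* a (b ℕ.* c)) (cong (+ a *_) (pos-* b c))

  cast-edges₂ : ∀ r j → + edges₂ r j ≡ edges₂ᶻ (+ r) (+ j)
  cast-edges₂ r j = cong₂ _+_ (pos-* (r ℕ.+ ℕ.suc j) (r ℕ.+ j)) (pos-* 2 r)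

  cast-qcP₂ : ∀ r j → + qcP₂ r j ≡ qcP₂ᶻ (+ r) (+ j)
  cast-qcP₂ r j = cong₂ _+_ (cong₂ _+_ (pos-*-* r (r ℕ.+ ℕ.suc j) (r ℕ.+ ℕ.suc j))
                                       (pos-*-* (ℕ.suc j) (r ℕ.+ j) (r ℕ.+ j)))
                            (pos-* r r)

  excess-positive : ∀ r j R J z n → n ≡ R ℕ.+ ℕ.suc J ℕ.+ z →
    edges₂ r j ℕ.+ edges₂ R J ≡ ℕ.suc n ℕ.* n →
    8 ℕ.≤ edges₂ r j →
    edges₂ r j ℕ.+ 2 ℕ.* ℕ.suc n ℕ.+ 2 ℕ.≤ edges₂ R J →
    qcP₂ r j ℕ.+ 2 ℕ.* n ℕ.* edges₂ R J ℕ.< ℕ.suc n ℕ.* (n ℕ.* n) ℕ.+ qcP₂ R J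
  excess-positive r j R J z _ refl edges e≥4 window = drop‿+<+ (subst₂ _<_ (sym lhs) (sym rhs)
    (excess-positiveᶻ (+ r) (+ j) (+ R) (+ J) (+ z) (0≤-ℕ r) (0≤-ℕ j) (0≤-ℕ R) (0≤-ℕ J) (0≤-ℕ z) edges′
      (subst (+ 8 ≤_) (cast-edges₂ r j) (+≤+ e≥4))
      (subst₂ _≤_ (cong (_+ + 2) (cong₂ _+_ (cast-edges₂ r j) (pos-* 2 (ℕ.suc n)))) (cast-edges₂ R J)
              (+≤+ window))))
    where
    n : ℕ
    n = R ℕ.+ ℕ.suc J ℕ.+ z
    edges′ : edges₂ᶻ (+ r) (+ j) + edges₂ᶻ (+ R) (+ J) ≡ + ℕ.suc n * + n
    edges′ = trans (sym (cong₂ _+_ (cast-edges₂ r j) (cast-edges₂ R J))) (trans (cong +_ edges) (pos-* (ℕ.suc n) n))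
    lhs : + (qcP₂ r j ℕ.+ 2 ℕ.* n ℕ.* edges₂ R J) ≡ qcP₂ᶻ (+ r) (+ j) + + 2 * + n * edges₂ᶻ (+ R) (+ J)
    lhs = cong₂ _+_ (cast-qcP₂ r j)
                    (trans (pos-* (2 ℕ.* n) (edges₂ R J)) (cong₂ _*_ (pos-* 2 n) (cast-edges₂ R J)))
    rhs : + (ℕ.suc n ℕ.* (n ℕ.* n) ℕ.+ qcP₂ R J) ≡ + ℕ.suc n * (+ n * + n) + qcP₂ᶻ (+ R) (+ J)
    rhs = cong₂ _+_ (pos-*-* (ℕ.suc n) n n) (cast-qcP₂ R J)

open import Defs
open import Data.Nat.Base
  using (ℕ; zero; suc; _+_; _*_; _∸_; _≡ᵇ_; _<ᵇ_; _≤_; _<_; z≤n; s≤s; z<s; s<s; s≤s⁻¹; _≤′_; ≤′-refl; ≤′-step)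
open import Data.Nat.Properties
open import Data.Nat.ListAction using (sum)
open import Data.Nat.Combinatorics using (_C_; nCk+nC[k+1]≡[n+1]C[k+1]; nC1≡n)
open import Data.Nat.Tactic.RingSolver using (solve-∀)
open import Data.Bool.Base using (Bool; true; false; T; not; _∧_; _∨_; if_then_else_)
open import Data.Bool.Properties using (∧-identityʳ; ∧-zeroʳ; ∨-identityʳ)
open import Data.Fin.Base using (Fin; toℕ)
open import Data.Fin.Properties using (toℕ-injective; toℕ<n) renaming (_≟_ to _≟ᶠ_)
open import Data.List.Base using (List; []; _∷_; map; allFin; tabulate)
open import Data.List.Properties using (map-cong; map-tabulate; tabulate-cong)
open import Data.Product using (_×_; _,_; proj₁; proj₂)
open import Data.Empty using (⊥-elim)
open import Data.Unit using (tt)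
open import Function using (_∘_)
open import Relation.Nullary using (¬_; yes; no)
open import Relation.Nullary.Decidable using (⌊_⌋)
open import Relation.Binary.PropositionalEquality
  using (_≡_; _≢_; refl; sym; trans; cong; cong₂; subst; subst₂; module ≡-Reasoning)
open PolynomialInequality using (edges₂; qcP₂; excess-positive)

-- Finite sums.  Defs sums over the list allFin v; we also use Σ_{i<n} g i over labels,
-- which is easier to split into the blocks of vertices of a quasi-complete graph.

ind : Bool → ℕ
ind b = if b then 1 else 0

sum-map-+ : ∀ {A : Set} (f g : A → ℕ) xs →
  sum (map (λ x → f x + g x) xs) ≡ sum (map f xs) + sum (map g xs)
sum-map-+ f g []       = refl
sum-map-+ f g (x ∷ xs) = begin
  f x + g x + sum (map (λ x → f x + g x) xs)     ≡⟨ cong (f x + g x +_) (sum-map-+ f g xs) ⟩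
  f x + g x + (sum (map f xs) + sum (map g xs))  ≡⟨ interchange (f x) (g x) _ _ ⟩
  f x + sum (map f xs) + (g x + sum (map g xs))  ∎
  where
  open ≡-Reasoning
  interchange : ∀ a b c d → a + b + (c + d) ≡ a + c + (b + d)
  interchange = solve-∀

sum-map-*ˡ : ∀ {A : Set} c (f : A → ℕ) xs → sum (map (λ x → c * f x) xs) ≡ c * sum (map f xs)
sum-map-*ˡ c f []       = sym (*-zeroʳ c)
sum-map-*ˡ c f (x ∷ xs) =
  trans (cong (c * f x +_) (sum-map-*ˡ c f xs)) (sym (*-distribˡ-+ c (f x) (sum (map f xs))))

sumBelow : ℕ → (ℕ → ℕ) → ℕ
sumBelow zero    g = 0
sumBelow (suc n) g = g 0 + sumBelow n (g ∘ suc)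

sum-allFin : ∀ n (F : Fin n → ℕ) (g : ℕ → ℕ) → (∀ a → F a ≡ g (toℕ a)) →
  sum (map F (allFin n)) ≡ sumBelow n g
sum-allFin n F g F≗g = begin
  sum (map F (allFin n))           ≡⟨ cong sum (map-tabulate (λ a → a) F) ⟩
  sum (tabulate F)                 ≡⟨ cong sum (tabulate-cong F≗g) ⟩
  sum (tabulate {n = n} (g ∘ toℕ)) ≡⟨ tabulated n g ⟩
  sumBelow n g                     ∎
  where
  open ≡-Reasoning
  tabulated : ∀ n (g : ℕ → ℕ) → sum (tabulate {n = n} (g ∘ toℕ)) ≡ sumBelow n g
  tabulated zero    g = refl
  tabulated (suc n) g = cong (g 0 +_) (tabulated n (g ∘ suc))

sumBelow-cong : ∀ n {f g : ℕ → ℕ} → (∀ i → i < n → f i ≡ g i) → sumBelow n f ≡ sumBelow n g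
sumBelow-cong zero    f≗g = refl
sumBelow-cong (suc n) f≗g =
  cong₂ _+_ (f≗g 0 z<s) (sumBelow-cong n (λ i i<n → f≗g (suc i) (s<s i<n)))

sumBelow-+ : ∀ n (f g : ℕ → ℕ) → sumBelow n (λ i → f i + g i) ≡ sumBelow n f + sumBelow n g
sumBelow-+ zero    f g = refl
sumBelow-+ (suc n) f g = trans (cong (f 0 + g 0 +_) (sumBelow-+ n (f ∘ suc) (g ∘ suc)))
                               (interchange (f 0) (g 0) _ _)
  where
  interchange : ∀ a b c d → a + b + (c + d) ≡ a + c + (b + d)
  interchange = solve-∀

sumBelow-split : ∀ m n (f : ℕ → ℕ) → sumBelow (m + n) f ≡ sumBelow m f + sumBelow n (λ i → f (m + i))
sumBelow-split zero    n f = refl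
sumBelow-split (suc m) n f =
  trans (cong (f 0 +_) (sumBelow-split m n (f ∘ suc))) (sym (+-assoc (f 0) _ _))

sumBelow-const : ∀ n c (f : ℕ → ℕ) → (∀ i → i < n → f i ≡ c) → sumBelow n f ≡ n * c
sumBelow-const zero    c f f≡c = refl
sumBelow-const (suc n) c f f≡c =
  cong₂ _+_ (f≡c 0 z<s) (sumBelow-const n c (f ∘ suc) (λ i i<n → f≡c (suc i) (s<s i<n)))

sumBelow-0 : ∀ n (f : ℕ → ℕ) → (∀ i → i < n → f i ≡ 0) → sumBelow n f ≡ 0
sumBelow-0 n f f≡0 = trans (sumBelow-const n 0 f f≡0) (*-zeroʳ n)

count-below : ∀ n m → m ≤ n → sumBelow n (λ y → ind (y <ᵇ m)) ≡ m
count-below n       zero    _         = sumBelow-0 n _ (λ _ _ → refl)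
count-below (suc n) (suc m) (s≤s m≤n) = cong suc (count-below n m m≤n)

count-equal : ∀ n x → x < n → sumBelow n (λ y → ind (x ≡ᵇ y)) ≡ 1
count-equal (suc n) zero    _         = cong suc (sumBelow-0 n _ (λ _ _ → refl))
count-equal (suc n) (suc x) (s≤s x<n) = count-equal n x x<n

sum-allFin-const : ∀ n c → sum (map (λ (_ : Fin n) → c) (allFin n)) ≡ n * c
sum-allFin-const n c = trans (sum-allFin n _ (λ _ → c) (λ _ → refl)) (sumBelow-const n c _ (λ _ _ → refl))

true-if : ∀ {b} → T b → b ≡ true
true-if {true} _ = refl

false-unless : ∀ {b} → ¬ T b → b ≡ false
false-unless {false} _   = refl
false-unless {true}  ¬tt = ⊥-elim (¬tt tt)

<ᵇ-true : ∀ {m n} → m < n → (m <ᵇ n) ≡ true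
<ᵇ-true m<n = true-if (<⇒<ᵇ m<n)

<ᵇ-false : ∀ {m n} → n ≤ m → (m <ᵇ n) ≡ false
<ᵇ-false {m} {n} n≤m = false-unless (λ t → <⇒≱ (<ᵇ⇒< m n t) n≤m)

≡ᵇ-refl : ∀ m → (m ≡ᵇ m) ≡ true
≡ᵇ-refl m = true-if (≡⇒≡ᵇ m m refl)

≡ᵇ-false : ∀ {m n} → m ≢ n → (m ≡ᵇ n) ≡ false
≡ᵇ-false {m} {n} m≢n = false-unless (m≢n ∘ ≡ᵇ⇒≡ m n)

≟-as-≡ᵇ : ∀ {v} (a b : Fin v) → ⌊ a ≟ᶠ b ⌋ ≡ (toℕ a ≡ᵇ toℕ b)
≟-as-≡ᵇ a b with a ≟ᶠ b
... | yes refl = sym (≡ᵇ-refl (toℕ a))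
... | no  a≢b  = sym (≡ᵇ-false (a≢b ∘ toℕ-injective))

-- Complements.  In a loopless graph on n + 1 vertices each vertex is adjacent, in exactly
-- one of G and its complement, to each other vertex; so the degrees are n − d.

degreeSum : ∀ {v} → Graph v → ℕ
degreeSum {v} G = sum (map (degree G) (allFin v))

Loopless : ∀ {v} → Graph v → Set
Loopless G = ∀ a → G a a ≡ false

degree-complement : ∀ {n} (G : Graph (suc n)) → Loopless G →
  ∀ a → degree (complement G) a + degree G a ≡ n
degree-complement {n} G loopless a = suc-injective (begin
  suc (dᶜ + d)                                      ≡⟨ +-comm 1 (dᶜ + d) ⟩
  dᶜ + d + 1                                        ≡⟨ cong (dᶜ + d +_) (sym self) ⟩
  dᶜ + d + sum (map (ind ∘ same) vs)
    ≡⟨ cong (_+ sum (map (ind ∘ same) vs)) (sym (sum-map-+ inᶜ in′ vs)) ⟩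
  sum (map (λ b → inᶜ b + in′ b) vs) + sum (map (ind ∘ same) vs)
    ≡⟨ sym (sum-map-+ (λ b → inᶜ b + in′ b) (ind ∘ same) vs) ⟩
  sum (map (λ b → inᶜ b + in′ b + ind (same b)) vs) ≡⟨ cong sum (map-cong exactly-one vs) ⟩
  sum (map (λ _ → 1) vs)                            ≡⟨ sum-allFin-const (suc n) 1 ⟩
  suc n * 1                                         ≡⟨ *-identityʳ (suc n) ⟩
  suc n                                             ∎)
  where
  open ≡-Reasoning
  vs : List (Fin (suc n))
  vs = allFin (suc n)
  inᶜ in′ : Fin (suc n) → ℕ
  inᶜ b = ind (complement G a b)
  in′ b = ind (G a b)
  dᶜ d : ℕ
  dᶜ = degree (complement G) a
  d  = degree G a
  same : Fin (suc n) → Bool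
  same b = ⌊ a ≟ᶠ b ⌋
  self : sum (map (ind ∘ same) vs) ≡ 1
  self = trans (sum-allFin (suc n) (ind ∘ same) (λ y → ind (toℕ a ≡ᵇ y)) (λ b → cong ind (≟-as-≡ᵇ a b)))
               (count-equal (suc n) (toℕ a) (toℕ<n a))
  exactly-one : ∀ b → inᶜ b + in′ b + ind (same b) ≡ 1
  exactly-one b with a ≟ᶠ b
  ... | yes refl rewrite loopless a = refl
  ... | no  _    with G a b
  ...   | true  = refl
  ...   | false = refl

-- P₂(Ḡ) = Σ (n − d)² = (n + 1)n² − 2n Σ d + P₂(G), stated without subtraction.
P₂-complement : ∀ {n} (G : Graph (suc n)) → Loopless G →
  P₂ (complement G) + 2 * n * degreeSum G ≡ suc n * (n * n) + P₂ G
P₂-complement {n} G loopless = begin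
  P₂ (complement G) + 2 * n * degreeSum G
    ≡⟨ cong (P₂ (complement G) +_) (sym (sum-map-*ˡ (2 * n) (degree G) vs)) ⟩
  P₂ (complement G) + sum (map (λ a → 2 * n * degree G a) vs)
    ≡⟨ sym (sum-map-+ (λ a → dᶜ a * dᶜ a) (λ a → 2 * n * degree G a) vs) ⟩
  sum (map (λ a → dᶜ a * dᶜ a + 2 * n * degree G a) vs)
    ≡⟨ cong sum (map-cong shift vs) ⟩
  sum (map (λ a → n * n + degree G a * degree G a) vs)
    ≡⟨ sum-map-+ (λ _ → n * n) (λ a → degree G a * degree G a) vs ⟩
  sum (map (λ _ → n * n) vs) + P₂ G
    ≡⟨ cong (_+ P₂ G) (sum-allFin-const (suc n) (n * n)) ⟩
  suc n * (n * n) + P₂ G ∎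
  where
  open ≡-Reasoning
  vs : List (Fin (suc n))
  vs = allFin (suc n)
  dᶜ : Fin (suc n) → ℕ
  dᶜ = degree (complement G)
  square-shift : ∀ c d → c * c + 2 * (c + d) * d ≡ (c + d) * (c + d) + d * d
  square-shift = solve-∀
  shift : ∀ a → dᶜ a * dᶜ a + 2 * n * degree G a ≡ n * n + degree G a * degree G a
  shift a = subst (λ m → dᶜ a * dᶜ a + 2 * m * degree G a ≡ m * m + degree G a * degree G a)
                  (degree-complement G loopless a) (square-shift (dᶜ a) (degree G a))

choose2-suc : ∀ n → suc n C 2 ≡ n + n C 2
choose2-suc n = trans (sym (nCk+nC[k+1]≡[n+1]C[k+1] n 1)) (cong (_+ n C 2) (nC1≡n n))

double-choose2 : ∀ n → 2 * (suc n C 2) ≡ suc n * n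
double-choose2 zero    = refl
double-choose2 (suc n) = begin
  2 * (suc (suc n) C 2)       ≡⟨ cong (2 *_) (choose2-suc (suc n)) ⟩
  2 * (suc n + suc n C 2)     ≡⟨ *-distribˡ-+ 2 (suc n) (suc n C 2) ⟩
  2 * suc n + 2 * (suc n C 2) ≡⟨ cong (2 * suc n +_) (double-choose2 n) ⟩
  2 * suc n + suc n * n       ≡⟨ expand n ⟩
  suc (suc n) * suc n         ∎
  where
  open ≡-Reasoning
  expand : ∀ n → 2 * suc n + suc n * n ≡ suc (suc n) * suc n
  expand = solve-∀

choose2-mono : ∀ {m n} → m ≤ n → m C 2 ≤ n C 2
choose2-mono m≤n = mono (≤⇒≤′ m≤n)
  where
  mono : ∀ {m n} → m ≤′ n → m C 2 ≤ n C 2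
  mono ≤′-refl         = ≤-refl
  mono (≤′-step {n} p) = ≤-trans (mono p) (subst (n C 2 ≤_) (sym (choose2-suc n)) (m≤n+m (n C 2) n))

-- The parameters of e.  kOf e is the row k with C(k,2) ≤ e < C(k+1,2), so e = C(k,2) + r
-- with 0 ≤ r < k, jOf e = k − r, and the graph's apex k is joined to r = k − j vertices.

kOf-bounds : ∀ e → kOf e C 2 ≤ e × e < suc (kOf e) C 2
kOf-bounds zero = z≤n , s≤s z≤n
kOf-bounds (suc e) with kOf-bounds e | suc e ≡ᵇ suc (kOf e) C 2 in row-complete
... | lo , hi | true  = ≤-reflexive (sym full) , subst (_< suc (suc (kOf e)) C 2) (sym full)
                          (subst (suc (kOf e) C 2 <_) (sym (choose2-suc (suc (kOf e)))) (m<n+m _ z<s))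
  where
  full : suc e ≡ suc (kOf e) C 2
  full = ≡ᵇ⇒≡ (suc e) _ (subst T (sym row-complete) tt)
... | lo , hi | false = m≤n⇒m≤1+n lo , ≤∧≢⇒< hi (λ full → subst T row-complete (≡⇒≡ᵇ (suc e) _ full))

-- e = C(k,2) + r with k = r + j + 1 (here j is the paper's j minus one).
record Shape (e : ℕ) : Set where
  field
    r j  : ℕ
    kOf≡ : kOf e ≡ r + suc j
    r≡   : kOf e ∸ jOf e ≡ r
    e≡   : e ≡ (r + suc j) C 2 + r

shape : ∀ e → Shape e
shape e = record { r = r ; j = j ; kOf≡ = k≡ ; r≡ = k∸jOf≡r ; e≡ = trans e≡ (cong (λ t → t C 2 + r) k≡) }
  where
  k c r j : ℕ
  k = kOf e
  c = k C 2
  r = e ∸ c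
  j = k ∸ suc r
  e≡ : e ≡ c + r
  e≡ = sym (m+[n∸m]≡n (proj₁ (kOf-bounds e)))
  r<k : r < k
  r<k = +-cancelˡ-< c r k (begin-strict
    c + r     ≡⟨ sym e≡ ⟩
    e         <⟨ proj₂ (kOf-bounds e) ⟩
    suc k C 2 ≡⟨ choose2-suc k ⟩
    k + c     ≡⟨ +-comm k c ⟩
    c + k     ∎)
    where open ≤-Reasoning
  k≡ : k ≡ r + suc j
  k≡ = trans (sym (m+[n∸m]≡n r<k)) (sym (+-suc r j))
  jOf≡ : jOf e ≡ suc j
  jOf≡ = begin
    suc k C 2 ∸ e           ≡⟨ cong₂ _∸_ (choose2-suc k) e≡ ⟩
    k + c ∸ (c + r)         ≡⟨ cong (λ t → t + c ∸ (c + r)) k≡ ⟩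
    r + suc j + c ∸ (c + r) ≡⟨ cong (_∸ (c + r)) (rearrange r j c) ⟩
    c + r + suc j ∸ (c + r) ≡⟨ m+n∸m≡n (c + r) (suc j) ⟩
    suc j                   ∎
    where
    open ≡-Reasoning
    rearrange : ∀ r j c → r + suc j + c ≡ c + r + suc j
    rearrange = solve-∀
  k∸jOf≡r : k ∸ jOf e ≡ r
  k∸jOf≡r = trans (cong₂ _∸_ k≡ jOf≡) (m+n∸n≡m r (suc j))

shape-edges : ∀ e → 2 * e ≡ edges₂ (Shape.r (shape e)) (Shape.j (shape e))
shape-edges e = begin
  2 * e                         ≡⟨ cong (2 *_) e≡ ⟩
  2 * ((r + suc j) C 2 + r)     ≡⟨ *-distribˡ-+ 2 ((r + suc j) C 2) r ⟩
  2 * ((r + suc j) C 2) + 2 * r ≡⟨ cong (λ k → 2 * (k C 2) + 2 * r) (+-suc r j) ⟩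
  2 * (suc (r + j) C 2) + 2 * r ≡⟨ cong (_+ 2 * r) (double-choose2 (r + j)) ⟩
  suc (r + j) * (r + j) + 2 * r ≡⟨ cong (λ k → k * (r + j) + 2 * r) (sym (+-suc r j)) ⟩
  edges₂ r j                    ∎
  where
  open ≡-Reasoning
  open Shape (shape e)

kOf-fits : ∀ {e v} → e < v C 2 → kOf e < v
kOf-fits e<N = ≰⇒> (λ v≤k → <⇒≱ e<N (≤-trans (choose2-mono v≤k) (proj₁ (kOf-bounds _))))

qcAdj : ℕ → ℕ → ℕ → ℕ → Bool
qcAdj k r x y = not (x ≡ᵇ y) ∧ (((x <ᵇ k) ∧ (y <ᵇ k)) ∨ ((x ≡ᵇ k) ∧ (y <ᵇ r)) ∨ ((y ≡ᵇ k) ∧ (x <ᵇ r)))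

quasiComplete-adj : ∀ v e (a b : Fin v) →
  quasiComplete v e a b ≡ qcAdj (kOf e) (kOf e ∸ jOf e) (toℕ a) (toℕ b)
quasiComplete-adj v e a b = cong (λ t → not t ∧ edge) (≟-as-≡ᵇ a b)
  where
  k r : ℕ
  k = kOf e
  r = kOf e ∸ jOf e
  edge : Bool
  edge = ((toℕ a <ᵇ k) ∧ (toℕ b <ᵇ k)) ∨ ((toℕ a ≡ᵇ k) ∧ (toℕ b <ᵇ r)) ∨ ((toℕ b ≡ᵇ k) ∧ (toℕ a <ᵇ r))

qcDegree : (k r v x : ℕ) → ℕ
qcDegree k r v x = sumBelow v (λ y → ind (qcAdj k r x y))

module _ {k r : ℕ} (r≤k : r ≤ k) where

  adj-clique : ∀ {x y} → x < k → y < k → qcAdj k r x y ≡ not (x ≡ᵇ y)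
  adj-clique {x} {y} x<k y<k rewrite <ᵇ-true x<k | <ᵇ-true y<k = ∧-identityʳ (not (x ≡ᵇ y))

  adj-to-apex : ∀ {x} → x < k → qcAdj k r x k ≡ (x <ᵇ r)
  adj-to-apex x<k rewrite ≡ᵇ-false (<⇒≢ x<k) | <ᵇ-true x<k | <ᵇ-false {k} {k} ≤-refl | ≡ᵇ-refl k = refl

  adj-from-apex : ∀ {y} → y < k → qcAdj k r k y ≡ (y <ᵇ r)
  adj-from-apex {y} y<k
    rewrite ≡ᵇ-false (>⇒≢ y<k) | <ᵇ-false {k} {k} ≤-refl | ≡ᵇ-refl k | ≡ᵇ-false (<⇒≢ y<k)
      = ∨-identityʳ (y <ᵇ r)

  adj-apex-self : qcAdj k r k k ≡ false
  adj-apex-self rewrite ≡ᵇ-refl k = refl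

  adj-beyond-target : ∀ {x y} → k < y → qcAdj k r x y ≡ false
  adj-beyond-target {x} {y} k<y
    rewrite <ᵇ-false {y} {k} (<⇒≤ k<y) | ≡ᵇ-false (>⇒≢ k<y) | <ᵇ-false {y} {r} (≤-trans r≤k (<⇒≤ k<y))
          | ∧-zeroʳ (x <ᵇ k) | ∧-zeroʳ (x ≡ᵇ k) = ∧-zeroʳ (not (x ≡ᵇ y))

  adj-beyond-source : ∀ {x y} → k < x → qcAdj k r x y ≡ false
  adj-beyond-source {x} {y} k<x
    rewrite <ᵇ-false {x} {k} (<⇒≤ k<x) | ≡ᵇ-false (>⇒≢ k<x) | <ᵇ-false {x} {r} (≤-trans r≤k (<⇒≤ k<x))
          | ∧-zeroʳ (y ≡ᵇ k) = ∧-zeroʳ (not (x ≡ᵇ y))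

  split-at-apex : ∀ z (f : ℕ → ℕ) →
    sumBelow (k + suc z) f ≡ sumBelow k f + f k + sumBelow z (λ i → f (suc (k + i)))
  split-at-apex z f = begin
    sumBelow (k + suc z) f                                        ≡⟨ sumBelow-split k (suc z) f ⟩
    sumBelow k f + (f (k + 0) + sumBelow z (λ i → f (k + suc i)))
      ≡⟨ cong (λ t → sumBelow k f + (f t + sumBelow z (λ i → f (k + suc i)))) (+-identityʳ k) ⟩
    sumBelow k f + (f k + sumBelow z (λ i → f (k + suc i)))
      ≡⟨ cong (λ t → sumBelow k f + (f k + t)) (sumBelow-cong z (λ i _ → cong f (+-suc k i))) ⟩
    sumBelow k f + (f k + sumBelow z (λ i → f (suc (k + i))))     ≡⟨ sym (+-assoc (sumBelow k f) (f k) _) ⟩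
    sumBelow k f + f k + sumBelow z (λ i → f (suc (k + i)))       ∎
    where open ≡-Reasoning

  deg-clique : ∀ z {x} → x < k → suc (qcDegree k r (k + suc z) x) ≡ k + ind (x <ᵇ r)
  deg-clique z {x} x<k = begin
    suc (qcDegree k r (k + suc z) x)
      ≡⟨ cong suc (split-at-apex z (λ y → ind (qcAdj k r x y))) ⟩
    suc (sumBelow k (λ y → ind (qcAdj k r x y)) + ind (qcAdj k r x k)
         + sumBelow z (λ i → ind (qcAdj k r x (suc (k + i)))))
      ≡⟨ cong suc (cong₂ _+_ (cong₂ _+_ (sumBelow-cong k (λ y y<k → cong ind (adj-clique x<k y<k)))
                                        (cong ind (adj-to-apex x<k)))
                             (sumBelow-0 z _ (λ i _ → cong ind (adj-beyond-target (s≤s (m≤m+n k i)))))) ⟩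
    suc (others + ind (x <ᵇ r) + 0)
      ≡⟨ cong suc (+-identityʳ (others + ind (x <ᵇ r))) ⟩
    suc others + ind (x <ᵇ r)
      ≡⟨ cong (_+ ind (x <ᵇ r)) others+1≡k ⟩
    k + ind (x <ᵇ r) ∎
    where
    open ≡-Reasoning
    others : ℕ
    others = sumBelow k (λ y → ind (not (x ≡ᵇ y)))
    either : ∀ b → ind (not b) + ind b ≡ 1
    either true  = refl
    either false = refl
    others+1≡k : suc others ≡ k
    others+1≡k = begin
      suc others                                           ≡⟨ +-comm 1 others ⟩
      others + 1                                           ≡⟨ cong (others +_) (sym (count-equal k x x<k)) ⟩
      others + sumBelow k (λ y → ind (x ≡ᵇ y))             ≡⟨ sym (sumBelow-+ k _ _) ⟩
      sumBelow k (λ y → ind (not (x ≡ᵇ y)) + ind (x ≡ᵇ y)) ≡⟨ sumBelow-const k 1 _ (λ y _ → either (x ≡ᵇ y)) ⟩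
      k * 1                                                ≡⟨ *-identityʳ k ⟩
      k                                                    ∎

  deg-apex : ∀ z → qcDegree k r (k + suc z) k ≡ r
  deg-apex z = begin
    qcDegree k r (k + suc z) k
      ≡⟨ split-at-apex z (λ y → ind (qcAdj k r k y)) ⟩
    sumBelow k (λ y → ind (qcAdj k r k y)) + ind (qcAdj k r k k) + sumBelow z (λ i → ind (qcAdj k r k (suc (k + i))))
      ≡⟨ cong₂ _+_ (cong₂ _+_ (sumBelow-cong k (λ y y<k → cong ind (adj-from-apex y<k)))
                              (cong ind adj-apex-self))
                   (sumBelow-0 z _ (λ i _ → cong ind (adj-beyond-target (s≤s (m≤m+n k i))))) ⟩
    sumBelow k (λ y → ind (y <ᵇ r)) + 0 + 0
      ≡⟨ trans (+-identityʳ _) (+-identityʳ _) ⟩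
    sumBelow k (λ y → ind (y <ᵇ r))
      ≡⟨ count-below k r r≤k ⟩
    r ∎
    where open ≡-Reasoning

  deg-beyond : ∀ v {x} → k < x → qcDegree k r v x ≡ 0
  deg-beyond v k<x = sumBelow-0 v _ (λ y _ → cong ind (adj-beyond-source k<x))

qc-degree-sum : ∀ (f : ℕ → ℕ) r j z →
  sumBelow (r + suc j + suc z) (λ x → f (qcDegree (r + suc j) r (r + suc j + suc z) x))
    ≡ r * f (r + suc j) + suc j * f (r + j) + f r + z * f 0
qc-degree-sum f r j z = begin
  sumBelow (k + suc z) F                                   ≡⟨ split-at-apex r≤k z F ⟩
  sumBelow k F + F k + sumBelow z (λ i → F (suc (k + i)))
    ≡⟨ cong₂ _+_ (cong₂ _+_ clique (cong f (deg-apex r≤k z)))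
                 (sumBelow-const z (f 0) _ (λ i _ → cong f (deg-beyond r≤k v (s≤s (m≤m+n k i))))) ⟩
  r * f k + suc j * f (r + j) + f r + z * f 0              ∎
  where
  open ≡-Reasoning
  k v : ℕ
  k = r + suc j
  v = k + suc z
  r≤k : r ≤ k
  r≤k = m≤m+n r (suc j)
  F : ℕ → ℕ
  F x = f (qcDegree k r v x)
  high : ∀ x → x < r → qcDegree k r v x ≡ k
  high x x<r = suc-injective (trans (deg-clique r≤k z (<-≤-trans x<r r≤k))
                                    (trans (cong (λ b → k + ind b) (<ᵇ-true x<r)) (+-comm k 1)))
  low : ∀ i → i < suc j → qcDegree k r v (r + i) ≡ r + j
  low i i<j = suc-injective (trans (deg-clique r≤k z (+-monoʳ-< r i<j))
                                   (trans (cong (λ b → k + ind b) (<ᵇ-false (m≤m+n r i)))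
                                          (trans (+-identityʳ k) (+-suc r j))))
  clique : sumBelow k F ≡ r * f k + suc j * f (r + j)
  clique = trans (sumBelow-split r (suc j) F)
    (cong₂ _+_ (sumBelow-const r (f k) F (λ x x<r → cong f (high x x<r)))
               (sumBelow-const (suc j) (f (r + j)) _ (λ i i<j → cong f (low i i<j))))

qc-sum : ∀ v e (f : ℕ → ℕ) → kOf e < v →
  let open Shape (shape e) in
  sum (map (λ a → f (degree (quasiComplete v e) a)) (allFin v))
    ≡ r * f (r + suc j) + suc j * f (r + j) + f r + (v ∸ suc (kOf e)) * f 0
qc-sum v e f k<v = trans (sum-allFin v _ (λ x → f (qcDegree (kOf e) (kOf e ∸ jOf e) v x)) degree≡)
                         (by-shape kOf≡ r≡ v≡)
  where
  open Shape (shape e)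
  degree≡ : ∀ a → f (degree (quasiComplete v e) a) ≡ f (qcDegree (kOf e) (kOf e ∸ jOf e) v (toℕ a))
  degree≡ a = cong f (sum-allFin v _ _ (λ b → cong ind (quasiComplete-adj v e a b)))
  z : ℕ
  z = v ∸ suc (kOf e)
  v≡ : v ≡ r + suc j + suc z
  v≡ = trans (sym (m+[n∸m]≡n k<v)) (trans (sym (+-suc (kOf e) z)) (cong (_+ suc z) kOf≡))
  by-shape : ∀ {k r′ v} → k ≡ r + suc j → r′ ≡ r → v ≡ r + suc j + suc z →
    sumBelow v (λ x → f (qcDegree k r′ v x)) ≡ r * f (r + suc j) + suc j * f (r + j) + f r + z * f 0
  by-shape refl refl refl = qc-degree-sum f r j z

drop-isolated : ∀ a z → a + z * 0 ≡ a
drop-isolated a z = trans (cong (a +_) (*-zeroʳ z)) (+-identityʳ a)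

Cval-formula : ∀ v e → kOf e < v → Cval v e ≡ qcP₂ (Shape.r (shape e)) (Shape.j (shape e))
Cval-formula v e k<v = trans (qc-sum v e (λ d → d * d) k<v) (drop-isolated _ (v ∸ suc (kOf e)))

degreeSum-formula : ∀ v e → kOf e < v → degreeSum (quasiComplete v e) ≡ 2 * e
degreeSum-formula v e k<v = begin
  degreeSum (quasiComplete v e)
    ≡⟨ qc-sum v e (λ d → d) k<v ⟩
  r * (r + suc j) + suc j * (r + j) + r + (v ∸ suc (kOf e)) * 0
    ≡⟨ drop-isolated (r * (r + suc j) + suc j * (r + j) + r) (v ∸ suc (kOf e)) ⟩
  r * (r + suc j) + suc j * (r + j) + r
    ≡⟨ handshake r j ⟩
  edges₂ r j
    ≡⟨ sym (shape-edges e) ⟩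
  2 * e ∎
  where
  open ≡-Reasoning
  open Shape (shape e)
  handshake : ∀ r j → r * (r + suc j) + suc j * (r + j) + r ≡ (r + suc j) * (r + j) + 2 * r
  handshake = solve-∀

quasiComplete-loopless : ∀ v e → Loopless (quasiComplete v e)
quasiComplete-loopless v e a = trans (quasiComplete-adj v e a a) (qcAdj-irreflexive (toℕ a))
  where
  qcAdj-irreflexive : ∀ x → qcAdj (kOf e) (kOf e ∸ jOf e) x x ≡ false
  qcAdj-irreflexive x rewrite ≡ᵇ-refl x = refl

Sval-formula : ∀ n e → kOf (suc n C 2 ∸ e) < suc n →
  Sval (suc n) e + 2 * n * (2 * (suc n C 2 ∸ e)) ≡ suc n * (n * n) + Cval (suc n) (suc n C 2 ∸ e)
Sval-formula n e K<v =
  trans (cong (λ t → Sval (suc n) e + 2 * n * t) (sym (degreeSum-formula (suc n) e′ K<v)))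
        (P₂-complement (quasiComplete (suc n) e′) (quasiComplete-loopless (suc n) e′))
  where
  e′ : ℕ
  e′ = suc n C 2 ∸ e

symmetry : ∀ n e → e ≤ suc n C 2 → kOf e < suc n → kOf (suc n C 2 ∸ e) < suc n →
  Sval (suc n) e + Sval (suc n) (suc n C 2 ∸ e) ≡ Cval (suc n) e + Cval (suc n) (suc n C 2 ∸ e)
symmetry n e e≤N k<v K<v = +-cancelʳ-≡ (w + w) (S + S′) (Cₑ + Cₑ′) (begin
  S + S′ + (w + w)                                 ≡⟨ cong (λ t → S + S′ + t) (sym cross) ⟩
  S + S′ + (2 * n * (2 * e′) + 2 * n * (2 * e))    ≡⟨ interchange S S′ _ _ ⟩
  (S + 2 * n * (2 * e′)) + (S′ + 2 * n * (2 * e))  ≡⟨ cong₂ _+_ (Sval-formula n e K<v) Sval-e′ ⟩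
  (w + Cₑ′) + (w + Cₑ)                             ≡⟨ regroup w Cₑ Cₑ′ ⟩
  Cₑ + Cₑ′ + (w + w)                               ∎)
  where
  open ≡-Reasoning
  v N e′ w S S′ Cₑ Cₑ′ : ℕ
  v = suc n
  N = v C 2
  e′ = N ∸ e
  w = v * (n * n)
  S = Sval v e
  S′ = Sval v e′
  Cₑ = Cval v e
  Cₑ′ = Cval v e′
  interchange : ∀ a b c d → a + b + (c + d) ≡ (a + c) + (b + d)
  interchange = solve-∀
  regroup : ∀ w c c′ → (w + c′) + (w + c) ≡ c + c′ + (w + w)
  regroup = solve-∀
  N∸e′≡e : N ∸ e′ ≡ e
  N∸e′≡e = m∸[m∸n]≡n e≤N
  Sval-e′ : S′ + 2 * n * (2 * e) ≡ w + Cₑ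
  Sval-e′ = subst (λ t → S′ + 2 * n * (2 * t) ≡ w + Cval v t) N∸e′≡e
                  (Sval-formula n e′ (subst (λ t → kOf t < v) (sym N∸e′≡e) k<v))
  cross : 2 * n * (2 * e′) + 2 * n * (2 * e) ≡ w + w
  cross = begin
    2 * n * (2 * e′) + 2 * n * (2 * e) ≡⟨ collect n e e′ ⟩
    2 * n * (2 * (e + e′))             ≡⟨ cong (λ t → 2 * n * (2 * t)) (m+[n∸m]≡n e≤N) ⟩
    2 * n * (2 * N)                    ≡⟨ cong (2 * n *_) (double-choose2 n) ⟩
    2 * n * (suc n * n)                ≡⟨ spread n ⟩
    w + w                              ∎
    where
    collect : ∀ n e e′ → 2 * n * (2 * e′) + 2 * n * (2 * e) ≡ 2 * n * (2 * (e + e′))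
    collect = solve-∀
    spread : ∀ n → 2 * n * (suc n * n) ≡ suc n * (n * n) + suc n * (n * n)
    spread = solve-∀

-- The edge-count window 2e + v < C(v,2) = e + e′ says e′ − e ≥ v + 1; doubled for edges₂.
doubled-window : ∀ e e′ v → 2 * e + v < e + e′ → 2 * e + 2 * v + 2 ≤ 2 * e′
doubled-window e e′ v window = subst (_≤ 2 * e′) (double-suc e v) (*-monoʳ-≤ 2 e+v<e′)
  where
  split : ∀ e v → 2 * e + v ≡ e + (e + v)
  split = solve-∀
  double-suc : ∀ e v → 2 * suc (e + v) ≡ 2 * e + 2 * v + 2
  double-suc = solve-∀
  e+v<e′ : e + v < e′
  e+v<e′ = +-cancelˡ-< e (e + v) e′ (subst (_< e + e′) (split e v) window)

star-beats-complete : ∀ n e → 4 ≤ e → 2 * e + suc n < suc n C 2 → Cval (suc n) e < Sval (suc n) e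
star-beats-complete n e 4≤e window = +-cancelʳ-< (2 * n * (2 * e′)) (Cval v e) (Sval v e) (begin-strict
  Cval v e + 2 * n * (2 * e′)    ≡⟨ cong₂ (λ a b → a + 2 * n * b) (Cval-formula v e k<v) (shape-edges e′) ⟩
  qcP₂ r j + 2 * n * edges₂ R J  <⟨ excess-positive r j R J z n n≡ edges e≥4 window′ ⟩
  v * (n * n) + qcP₂ R J         ≡⟨ cong (λ t → v * (n * n) + t) (sym (Cval-formula v e′ K<v)) ⟩
  v * (n * n) + Cval v e′        ≡⟨ sym (Sval-formula n e K<v) ⟩
  Sval v e + 2 * n * (2 * e′)    ∎)
  where
  open ≤-Reasoning
  v N e′ : ℕ
  v = suc n
  N = v C 2
  e′ = N ∸ e
  e<N : e < N
  e<N = ≤-<-trans (≤-trans (m≤m+n e (e + 0)) (m≤m+n (2 * e) v)) window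
  e+e′≡N : e + e′ ≡ N
  e+e′≡N = m+[n∸m]≡n (<⇒≤ e<N)
  e′<N : e′ < N
  e′<N = subst (e′ <_) (trans (+-comm e′ e) e+e′≡N) (m<m+n e′ (≤-trans (s≤s z≤n) 4≤e))
  k<v : kOf e < v
  k<v = kOf-fits e<N
  K<v : kOf e′ < v
  K<v = kOf-fits e′<N
  open Shape (shape e) using (r; j)
  open Shape (shape e′) using () renaming (r to R; j to J; kOf≡ to K≡)
  z : ℕ
  z = n ∸ (R + suc J)
  n≡ : n ≡ R + suc J + z
  n≡ = sym (m+[n∸m]≡n (subst (_≤ n) K≡ (s≤s⁻¹ K<v)))
  edges : edges₂ r j + edges₂ R J ≡ suc n * n
  edges = begin-equality
    edges₂ r j + edges₂ R J ≡⟨ sym (cong₂ _+_ (shape-edges e) (shape-edges e′)) ⟩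
    2 * e + 2 * e′          ≡⟨ sym (*-distribˡ-+ 2 e e′) ⟩
    2 * (e + e′)            ≡⟨ cong (2 *_) e+e′≡N ⟩
    2 * N                   ≡⟨ double-choose2 n ⟩
    suc n * n               ∎
  e≥4 : 8 ≤ edges₂ r j
  e≥4 = subst (8 ≤_) (shape-edges e) (*-monoʳ-≤ 2 4≤e)
  window′ : edges₂ r j + 2 * suc n + 2 ≤ edges₂ R J
  window′ = subst₂ (λ a b → a + 2 * suc n + 2 ≤ b) (shape-edges e) (shape-edges e′)
                   (doubled-window e e′ v (subst (2 * e + v <_) (sym e+e′≡N) window))

mirror-window : ∀ N v e e′ → e + e′ ≡ N → N + v < 2 * e → 2 * e′ + v < N
mirror-window N v e e′ e+e′≡N window = +-cancelˡ-< N (2 * e′ + v) N (begin-strict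
  N + (2 * e′ + v) ≡⟨ swap N (2 * e′) v ⟩
  N + v + 2 * e′   <⟨ +-monoˡ-< (2 * e′) window ⟩
  2 * e + 2 * e′   ≡⟨ sym (*-distribˡ-+ 2 e e′) ⟩
  2 * (e + e′)     ≡⟨ cong (2 *_) e+e′≡N ⟩
  2 * N            ≡⟨ double N ⟩
  N + N            ∎)
  where
  open ≤-Reasoning
  swap : ∀ a b c → a + (b + c) ≡ a + c + b
  swap = solve-∀
  double : ∀ a → 2 * a ≡ a + a
  double = solve-∀

-- Second half (v = n + 1): the first half for e′ = C(v,2) − e together with the symmetry.
complete-beats-star : ∀ n e → suc n C 2 + suc n < 2 * e → e + 4 ≤ suc n C 2 → Sval (suc n) e < Cval (suc n) e
complete-beats-star n e window e+4≤N = +-cancelʳ-< (Cval v e′) (Sval v e) (Cval v e) (begin-strict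
  Sval v e + Cval v e′  <⟨ +-monoʳ-< (Sval v e) (star-beats-complete n e′ 4≤e′ window′) ⟩
  Sval v e + Sval v e′  ≡⟨ symmetry n e e≤N k<v K<v ⟩
  Cval v e + Cval v e′  ∎)
  where
  open ≤-Reasoning
  v N e′ : ℕ
  v = suc n
  N = v C 2
  e′ = N ∸ e
  e≤N : e ≤ N
  e≤N = ≤-trans (m≤m+n e 4) e+4≤N
  e+e′≡N : e + e′ ≡ N
  e+e′≡N = m+[n∸m]≡n e≤N
  4≤e′ : 4 ≤ e′
  4≤e′ = +-cancelˡ-≤ e 4 e′ (subst (e + 4 ≤_) (sym e+e′≡N) e+4≤N)
  window′ : 2 * e′ + v < N
  window′ = mirror-window N v e e′ e+e′≡N window
  e<N : e < N
  e<N = <-≤-trans (m<m+n e (s≤s z≤n)) e+4≤N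
  0<e : 0 < e
  0<e = ≰⇒> (λ e≤0 → <⇒≱ window (≤-trans (*-monoʳ-≤ 2 e≤0) z≤n))
  e′<N : e′ < N
  e′<N = subst (e′ <_) (trans (+-comm e′ e) e+e′≡N) (m<m+n e′ 0<e)
  k<v : kOf e < v
  k<v = kOf-fits e<N
  K<v : kOf e′ < v
  K<v = kOf-fits e′<N

corollary2 : (v : ℕ) → 1 ≤ v →
    ((e : ℕ) → 4 ≤ e → 2 * e + v < v C 2 → Cval v e < Sval v e)
    × ((e : ℕ) → (v C 2) + v < 2 * e → e + 4 ≤ v C 2 → Sval v e < Cval v e)
corollary2 (suc n) _ = star-beats-complete n , complete-beats-star n
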